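{- Every strong degree of categoricity is treeable.
   Context: For a computable structure $\mathcal A$ in computable vocabulary $\tau$, with $(\mathcal B_e)_{e\in\omega}$ an enumeration of all computable $\tau$-structures, $CatSpec(\mathcal A)=\bigcap_{e:\mathcal B_e\cong\mathcal A}\{\deg(X): \exists f:\mathcal A\cong\mathcal B_e \text{ with } X\geq_T f\}$; if this set has a least element $\mathbf d$, $\mathbf d$ is the degree of categoricity of $\mathcal A$. A degree $\mathbf d$ is a strong degree of categoricity if there is a computable structure with degree of categoricity $\mathbf d$ having computable copies $\mathcal A_0,\mathcal A_1$ such that every isomorphism $f:\mathcal A_0\to\mathcal A_1$ satisfies $\deg(f)\geq\mathbf d$. A Turing degree $\mathbf d$ is treeable if there is a $\Pi^0_1$ class $P\subseteq\omega^\omega$ (i.e., $P=[T]$ for a computable tree $T\subseteq\omega^{<\omega}$) and some $p\in P$ with $\deg(p)=\mathbf d$ and $P\geq_w\{p\}$ (i.e., every element of $P$ computes $p$). -}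

module Defs where

open import Data.Nat using (ℕ; zero; suc; _+_; _<_)
open import Data.Fin using (Fin)
open import Data.Bool using (Bool; true; false; if_then_else_)
open import Data.Vec using (Vec; []; _∷_; lookup; toList)
import Data.Vec as Vec
open import Data.List using (List; []; _∷_; _++_)
open import Data.Product using (Σ; _×_; ∃; ∃-syntax)
open import Relation.Binary.PropositionalEquality using (_≡_)

-- Oracle computability: Kleene's μ-recursive functions relative to an
-- oracle α : ℕ → ℕ (elements of ω^ω; sets X ⊆ ω are 0/1-valued oracles).

data Code : ℕ → Set where
  zer  : ∀ {k} → Code k
  succ : Code 1
  proj : ∀ {k} → Fin k → Code k
  orc  : Code 1
  comp : ∀ {k m} → Code m → Vec (Code k) m → Code k
  prec : ∀ {k} → Code k → Code (suc (suc k)) → Code (suc k)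
  mu   : ∀ {k} → Code (suc k) → Code k

-- Big-step semantics:  Eval α c xs y  means  Φ^α_c(xs) ↓ = y.
mutual
  data Eval (α : ℕ → ℕ) : ∀ {k} → Code k → Vec ℕ k → ℕ → Set where
    e-zer  : ∀ {k} {xs : Vec ℕ k} → Eval α zer xs 0
    e-succ : ∀ {x} → Eval α succ (x ∷ []) (suc x)
    e-proj : ∀ {k} {i : Fin k} {xs} → Eval α (proj i) xs (lookup xs i)
    e-orc  : ∀ {x} → Eval α orc (x ∷ []) (α x)
    e-comp : ∀ {k m} {f : Code m} {gs : Vec (Code k) m} {xs ys y} →
             EvalAll α gs xs ys → Eval α f ys y → Eval α (comp f gs) xs y
    e-prec0 : ∀ {k} {g : Code k} {h xs y} →
              Eval α g xs y → Eval α (prec g h) (0 ∷ xs) y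
    e-precS : ∀ {k} {g : Code k} {h xs n z y} →
              Eval α (prec g h) (n ∷ xs) z →
              Eval α h (n ∷ z ∷ xs) y →
              Eval α (prec g h) (suc n ∷ xs) y
    e-mu   : ∀ {k} {g : Code (suc k)} {xs y} →
             Eval α g (y ∷ xs) 0 →
             (∀ z → z < y → Σ ℕ (λ w → Eval α g (z ∷ xs) (suc w))) →
             Eval α (mu g) xs y

  data EvalAll (α : ℕ → ℕ) {k : ℕ} : ∀ {m} → Vec (Code k) m → Vec ℕ k → Vec ℕ m → Set where
    []  : ∀ {xs} → EvalAll α [] xs []
    _∷_ : ∀ {m} {g : Code k} {gs : Vec (Code k) m} {xs y ys} →
          Eval α g xs y → EvalAll α gs xs ys → EvalAll α (g ∷ gs) xs (y ∷ ys)

_≤T_ : (ℕ → ℕ) → (ℕ → ℕ) → Set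
g ≤T α = Σ (Code 1) λ c → ∀ n → Eval α c (n ∷ []) (g n)

_≡T_ : (ℕ → ℕ) → (ℕ → ℕ) → Set
f ≡T g = (f ≤T g) × (g ≤T f)

∅ : ℕ → ℕ
∅ _ = 0

Computable : (ℕ → ℕ) → Set
Computable g = g ≤T ∅

tri : ℕ → ℕ
tri zero    = zero
tri (suc n) = suc n + tri n

pair : ℕ → ℕ → ℕ
pair x y = tri (x + y) + y

⌜_⌝ : List ℕ → ℕ
⌜ [] ⌝     = 0
⌜ x ∷ xs ⌝ = suc (pair x ⌜ xs ⌝)

b2n : Bool → ℕ
b2n true  = 1
b2n false = 0

-- A vocabulary: relation symbols R_0, R_1, … with arities ar i.
-- It is computable if ar is a computable function.
Vocab : Set
Vocab = ℕ → ℕ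

ComputableVocab : Vocab → Set
ComputableVocab ar = Computable ar

-- A τ-structure with domain ω, given by its atomic diagram.
Structure : Vocab → Set
Structure ar = (i : ℕ) → Vec ℕ (ar i) → Bool

ComputableStructure : (ar : Vocab) → Structure ar → Set
ComputableStructure ar A =
  Σ (Code 2) λ c → ∀ i (xs : Vec ℕ (ar i)) →
    Eval ∅ c (i ∷ ⌜ toList xs ⌝ ∷ []) (b2n (A i xs))

IsIso : (ar : Vocab) → Structure ar → Structure ar → (ℕ → ℕ) → Set
IsIso ar A B f =
  (∀ x y → f x ≡ f y → x ≡ y) ×
  (∀ y → ∃[ x ] f x ≡ y) ×
  (∀ i (xs : Vec ℕ (ar i)) → A i xs ≡ B i (Vec.map f xs))

InCatSpec : (ar : Vocab) → Structure ar → (ℕ → ℕ) → Set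
InCatSpec ar A X =
  ∀ (B : Structure ar) → ComputableStructure ar B →
    (∃[ g ] IsIso ar A B g) →
    ∃[ f ] (IsIso ar A B f × (f ≤T X))

IsDegreeOfCategoricity : (ar : Vocab) → Structure ar → (ℕ → ℕ) → Set
IsDegreeOfCategoricity ar A D =
  InCatSpec ar A D × (∀ X → InCatSpec ar A X → D ≤T X)

IsStrongDegreeOfCategoricity : (ℕ → ℕ) → Set
IsStrongDegreeOfCategoricity D =
  Σ Vocab λ ar → ComputableVocab ar ×
  Σ (Structure ar) λ A → ComputableStructure ar A ×
  IsDegreeOfCategoricity ar A D ×
  Σ (Structure ar) λ A₀ → ComputableStructure ar A₀ × (∃[ g ] IsIso ar A A₀ g) ×
  Σ (Structure ar) λ A₁ → ComputableStructure ar A₁ × (∃[ g ] IsIso ar A A₁ g) ×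
  (∀ f → IsIso ar A₀ A₁ f → D ≤T f)

_↾_ : (ℕ → ℕ) → ℕ → List ℕ
p ↾ zero  = []
p ↾ suc n = (p ↾ n) ++ (p n ∷ [])

IsComputableTree : (List ℕ → Bool) → Set
IsComputableTree T =
  (∀ σ τ → T (σ ++ τ) ≡ true → T σ ≡ true) ×
  (Σ (Code 1) λ c → ∀ σ → Eval ∅ c (⌜ σ ⌝ ∷ []) (b2n (T σ)))

IsPath : (List ℕ → Bool) → (ℕ → ℕ) → Set
IsPath T p = ∀ n → T (p ↾ n) ≡ true

Treeable : (ℕ → ℕ) → Set
Treeable D =
  Σ (List ℕ → Bool) λ T → IsComputableTree T ×
  Σ (ℕ → ℕ) λ p → IsPath T p × (p ≡T D) ×
  (∀ q → IsPath T q → p ≤T q)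

-- Let A₀, A₁ be computable copies of A such that every isomorphism A₀ ≅ A₁ computes D.
-- Code a pair of functions (f, g) as the single function p with p (2x) = f x and
-- p (2x+1) = g x. A computable tree accepts a finite sequence σ when σ, read as an
-- initial segment of such a p, shows no violation of g ∘ f = id, f ∘ g = id, or of
-- f preserving the atomic diagrams. Its paths are exactly the codes of an isomorphism
-- A₀ ≅ A₁ together with its inverse, so every path computes D. Conversely D, lying in
-- CatSpec(A), computes an isomorphism A₀ ≅ A₁ and, by an unbounded search, its inverse;
-- the path p coding them therefore has degree D and is computed by every path.

module Submission where

open import Defs
open import Data.Bool using (Bool; true; false)
open import Data.Empty using (⊥-elim)
open import Data.Fin using (Fin; zero; suc)
open import Data.List as List using (List; []; _∷_; length; drop; _++_)
open import Data.List.Properties using (length-drop; drop-drop; length-++)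
open import Data.Nat
open import Data.Nat.Properties
open import Data.Product using (Σ; _×_; _,_; proj₁; proj₂; ∃-syntax)
open import Data.Sum using (inj₁; inj₂)
open import Data.Vec as Vec using (Vec; []; _∷_; lookup; tabulate; toList)
open import Data.Vec.Properties using (tabulate∘lookup; map-∘; map-cong; map-id; toList-map; length-toList)
open import Function using (_∘_; _⇔_; mk⇔; Equivalence)
import Function.Properties.Equivalence as ⇔
open import Relation.Binary.Definitions using (tri<; tri≈; tri>)
open import Relation.Binary.PropositionalEquality
open import Relation.Nullary using (yes; no)

open Equivalence using () renaming (to to forward; from to backward)

private
  variable
    α : ℕ → ℕ
    a b k m n x y z : ℕ

-- Total programs

record Program (α : ℕ → ℕ) (k : ℕ) : Set where
  constructor program
  field
    code : Code k
    ⟦_⟧  : Vec ℕ k → ℕ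
    eval : ∀ xs → Eval α code xs (⟦ xs ⟧)
open Program public

_computes_by_ : (P : Program α k) (f : Vec ℕ k → ℕ) → (∀ xs → ⟦ P ⟧ xs ≡ f xs) → Program α k
_computes_by_ {α} P f eq = program (code P) f (λ xs → subst (Eval α (code P) xs) (eq xs) (eval P xs))

zeroᴾ : Program α k
zeroᴾ = program zer (λ _ → 0) (λ _ → e-zer)

succᴾ : Program α 1
succᴾ = program succ (λ { (x ∷ []) → suc x }) (λ { (x ∷ []) → e-succ })

projᴾ : Fin k → Program α k
projᴾ i = program (proj i) (λ xs → lookup xs i) (λ _ → e-proj)

codeAll : Vec (Program α k) m → Vec (Code k) m
codeAll []       = []
codeAll (P ∷ Ps) = code P ∷ codeAll Ps

⟦_⟧All : Vec (Program α k) m → Vec ℕ k → Vec ℕ m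
⟦ [] ⟧All     xs = []
⟦ P ∷ Ps ⟧All xs = ⟦ P ⟧ xs ∷ ⟦ Ps ⟧All xs

evalAll : (Ps : Vec (Program α k) m) → ∀ xs → EvalAll α (codeAll Ps) xs (⟦ Ps ⟧All xs)
evalAll []       xs = []
evalAll (P ∷ Ps) xs = eval P xs ∷ evalAll Ps xs

compᴾ : Program α m → Vec (Program α k) m → Program α k
compᴾ F Gs = program (comp (code F) (codeAll Gs)) (λ xs → ⟦ F ⟧ (⟦ Gs ⟧All xs))
                     (λ xs → e-comp (evalAll Gs xs) (eval F _))

primRec : (Vec ℕ k → ℕ) → (Vec ℕ (2 + k) → ℕ) → Vec ℕ (suc k) → ℕ
primRec g h (zero  ∷ xs) = g xs
primRec g h (suc n ∷ xs) = h (n ∷ primRec g h (n ∷ xs) ∷ xs)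

precᴾ : Program α k → Program α (2 + k) → Program α (suc k)
precᴾ {α} G H = program (prec (code G) (code H)) (primRec ⟦ G ⟧ ⟦ H ⟧) evalPrec
  where
    evalPrec : ∀ xs → Eval α (prec (code G) (code H)) xs (primRec ⟦ G ⟧ ⟦ H ⟧ xs)
    evalPrec (zero  ∷ xs) = e-prec0 (eval G xs)
    evalPrec (suc n ∷ xs) = e-precS (evalPrec (n ∷ xs)) (eval H _)

muᴾ : (G : Program α (suc k)) (f : Vec ℕ k → ℕ) →
      (∀ xs → ⟦ G ⟧ (f xs ∷ xs) ≡ 0) → (∀ xs z → z < f xs → ⟦ G ⟧ (z ∷ xs) ≢ 0) →
      Program α k
muᴾ {α} G f zero-at below-nonzero =
  program (mu (code G)) f
          (λ xs → e-mu (subst (Eval α (code G) (f xs ∷ xs)) (zero-at xs) (eval G _))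
                       (λ z z< → positive (below-nonzero xs z z<)))
  where
    positive : ∀ {zs} → ⟦ G ⟧ zs ≢ 0 → Σ ℕ λ w → Eval α (code G) zs (suc w)
    positive {zs} ≢0 with ⟦ G ⟧ zs | eval G zs
    ... | zero  | _ = ⊥-elim (≢0 refl)
    ... | suc w | e = w , e

app₁ : Program α 1 → Program α k → Program α k
app₁ F A = compᴾ F (A ∷ [])

app₂ : Program α 2 → Program α k → Program α k → Program α k
app₂ F A B = compᴾ F (A ∷ B ∷ [])

app₃ : Program α 3 → Program α k → Program α k → Program α k → Program α k
app₃ F A B C = compᴾ F (A ∷ B ∷ C ∷ [])

π₀ : Program α (1 + k)
π₀ = projᴾ zero

π₁ : Program α (2 + k)
π₁ = projᴾ (suc zero)

π₂ : Program α (3 + k)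
π₂ = projᴾ (suc (suc zero))

π₃ : Program α (4 + k)
π₃ = projᴾ (suc (suc (suc zero)))

π₄ : Program α (5 + k)
π₄ = projᴾ (suc (suc (suc (suc zero))))

constᴾ : ℕ → Program α k
constᴾ zero    = zeroᴾ
constᴾ (suc n) = app₁ succᴾ (constᴾ n)

-- Arithmetic and truth values, where a number counts as true when positive

sg : ℕ → ℕ
sg zero    = 0
sg (suc _) = 1

andₙ : ℕ → ℕ → ℕ
andₙ zero    b = 0
andₙ (suc _) b = b

impₙ : ℕ → ℕ → ℕ
impₙ zero    b = 1
impₙ (suc _) b = b

ifz : ℕ → ℕ → ℕ → ℕ
ifz zero    a b = a
ifz (suc _) a b = b

eqₙ : ℕ → ℕ → ℕ
eqₙ x y = 1 ∸ ∣ x - y ∣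

all< : (ℕ → ℕ) → ℕ → ℕ
all< P zero    = 1
all< P (suc n) = andₙ (all< P n) (P n)

sg-pos : 0 < sg x ⇔ 0 < x
sg-pos {zero}  = mk⇔ (λ ()) (λ ())
sg-pos {suc x} = mk⇔ (λ _ → z<s) (λ _ → z<s)

and-pos : 0 < andₙ a b ⇔ (0 < a × 0 < b)
and-pos {zero}  = mk⇔ (λ ()) (λ ())
and-pos {suc a} = mk⇔ (λ h → z<s , h) proj₂

imp-pos : 0 < impₙ a b ⇔ (0 < a → 0 < b)
imp-pos {zero}  = mk⇔ (λ _ ()) (λ _ → z<s)
imp-pos {suc a} = mk⇔ (λ h _ → h) (λ h → h z<s)

∸-pos : 0 < y ∸ x ⇔ x < y
∸-pos = mk⇔ (λ h → m∸n≢0⇒n<m (>⇒≢ h)) m<n⇒0<n∸m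

eq-pos : 0 < eqₙ x y ⇔ x ≡ y
eq-pos = mk⇔ (λ h → ∣m-n∣≡0⇒m≡n (n<1⇒n≡0 (forward ∸-pos h)))
             (λ x≡y → backward ∸-pos (s≤s (≤-reflexive (m≡n⇒∣m-n∣≡0 x≡y))))

all-pos : ∀ {P} → 0 < all< P n ⇔ (∀ j → j < n → 0 < P j)
all-pos {zero}  = mk⇔ (λ _ _ ()) (λ _ → z<s)
all-pos {suc n} {P} = mk⇔ split (λ h → backward and-pos (backward all-pos (λ j j< → h j (m<n⇒m<1+n j<)) , h n ≤-refl))
  where
    split : 0 < all< P (suc n) → ∀ j → j < suc n → 0 < P j
    split h j j< with forward and-pos h | m≤n⇒m<n∨m≡n (≤-pred j<)
    ... | below , _ | inj₁ j<n  = forward all-pos below j j<n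
    ... | _ , last  | inj₂ refl = last

nonzero : ℕ → Bool
nonzero zero    = false
nonzero (suc _) = true

nonzero-true : nonzero x ≡ true ⇔ 0 < x
nonzero-true {zero}  = mk⇔ (λ ()) (λ ())
nonzero-true {suc x} = mk⇔ (λ _ → z<s) (λ _ → refl)

b2n-nonzero-sg : ∀ x → b2n (nonzero (sg x)) ≡ sg x
b2n-nonzero-sg zero    = refl
b2n-nonzero-sg (suc x) = refl

b2n-injective : ∀ {p q} → b2n p ≡ b2n q → p ≡ q
b2n-injective {false} {false} _ = refl
b2n-injective {true}  {true}  _ = refl

addᴾ : Program α 2
addᴾ {α} = precᴾ π₀ (app₁ succᴾ π₁)
           computes (λ { (x ∷ y ∷ []) → x + y })
           by λ { (x ∷ y ∷ []) → sum x y }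
  where
    sum : ∀ x y → ⟦ precᴾ {α = α} π₀ (app₁ succᴾ π₁) ⟧ (x ∷ y ∷ []) ≡ x + y
    sum zero    y = refl
    sum (suc x) y = cong suc (sum x y)

predᴾ : Program α 1
predᴾ = precᴾ zeroᴾ π₀
        computes (λ { (x ∷ []) → pred x })
        by λ { (zero ∷ []) → refl ; (suc x ∷ []) → refl }

-- Primitive recursion iterates on the first argument, so the arguments of ∸ are swapped.
monusᴾ : Program α 2
monusᴾ {α} = app₂ (precᴾ π₀ (app₁ predᴾ π₁)) π₁ π₀
             computes (λ { (x ∷ y ∷ []) → x ∸ y })
             by λ { (x ∷ y ∷ []) → monus x y }
  where
    monus : ∀ x y → ⟦ precᴾ {α = α} π₀ (app₁ predᴾ π₁) ⟧ (y ∷ x ∷ []) ≡ x ∸ y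
    monus x zero    = refl
    monus x (suc y) = trans (cong pred (monus x y)) (pred[m∸n]≡m∸[1+n] x y)

∣-∣≡∸+∸ : ∀ x y → ∣ x - y ∣ ≡ (x ∸ y) + (y ∸ x)
∣-∣≡∸+∸ zero    zero    = refl
∣-∣≡∸+∸ zero    (suc y) = refl
∣-∣≡∸+∸ (suc x) zero    = sym (+-identityʳ (suc x))
∣-∣≡∸+∸ (suc x) (suc y) = ∣-∣≡∸+∸ x y

distᴾ : Program α 2
distᴾ = app₂ addᴾ (app₂ monusᴾ π₀ π₁) (app₂ monusᴾ π₁ π₀)
          computes (λ { (x ∷ y ∷ []) → ∣ x - y ∣ }) by λ { (x ∷ y ∷ []) → sym (∣-∣≡∸+∸ x y) }

eqᴾ : Program α 2
eqᴾ = app₂ monusᴾ (constᴾ 1) distᴾ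
      computes (λ { (x ∷ y ∷ []) → eqₙ x y })
      by λ { (x ∷ y ∷ []) → refl }

sgᴾ : Program α 1
sgᴾ = precᴾ zeroᴾ (constᴾ 1)
      computes (λ { (x ∷ []) → sg x })
      by λ { (zero ∷ []) → refl ; (suc x ∷ []) → refl }

andᴾ : Program α 2
andᴾ = precᴾ zeroᴾ π₂
       computes (λ { (a ∷ b ∷ []) → andₙ a b })
       by λ { (zero ∷ b ∷ []) → refl ; (suc a ∷ b ∷ []) → refl }

impᴾ : Program α 2
impᴾ = precᴾ (constᴾ 1) π₂
       computes (λ { (a ∷ b ∷ []) → impₙ a b })
       by λ { (zero ∷ b ∷ []) → refl ; (suc a ∷ b ∷ []) → refl }

ifzᴾ : Program α 3
ifzᴾ = precᴾ π₀ π₃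
       computes (λ { (v ∷ a ∷ b ∷ []) → ifz v a b })
       by λ { (zero ∷ a ∷ b ∷ []) → refl ; (suc v ∷ a ∷ b ∷ []) → refl }

doubleᴾ : Program α 1
doubleᴾ = app₂ addᴾ π₀ π₀ computes (λ { (x ∷ []) → x + x }) by λ { (x ∷ []) → refl }

triᴾ : Program α 1
triᴾ {α} = precᴾ zeroᴾ (app₁ succᴾ (app₂ addᴾ π₀ π₁))
           computes (λ { (x ∷ []) → tri x })
           by λ { (x ∷ []) → triangle x }
  where
    triangle : ∀ x → ⟦ precᴾ {α = α} zeroᴾ (app₁ succᴾ (app₂ addᴾ π₀ π₁)) ⟧ (x ∷ []) ≡ tri x
    triangle zero    = refl
    triangle (suc x) = cong (λ t → suc (x + t)) (triangle x)

⟦tabulate-proj⟧ : ∀ {n} (f : Fin m → Fin n) (ys : Vec ℕ n) →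
                  ⟦ tabulate (λ i → projᴾ {α = α} (f i)) ⟧All ys ≡ tabulate (lookup ys ∘ f)
⟦tabulate-proj⟧ {zero}  f ys = refl
⟦tabulate-proj⟧ {suc m} f ys = cong (lookup ys (f zero) ∷_) (⟦tabulate-proj⟧ (f ∘ suc) ys)

allᴾ : Program α (suc k) → Program α (suc k)
allᴾ {α} {k} P = B
                 computes (λ { (n ∷ xs) → all< (λ j → ⟦ P ⟧ (j ∷ xs)) n })
                 by λ { (n ∷ xs) → bounded n xs }
  where
    B : Program α (suc k)
    B = precᴾ (constᴾ 1) (app₂ andᴾ π₁ (compᴾ P (π₀ ∷ tabulate (λ i → projᴾ (suc (suc i))))))
    bounded : ∀ n xs → ⟦ B ⟧ (n ∷ xs) ≡ all< (λ j → ⟦ P ⟧ (j ∷ xs)) n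
    bounded zero    xs = refl
    bounded (suc n) xs =
      cong₂ andₙ (bounded n xs)
                 (cong (λ ys → ⟦ P ⟧ (n ∷ ys)) (trans (⟦tabulate-proj⟧ (λ i → suc (suc i)) _) (tabulate∘lookup xs)))

-- Cantor unpairing

tri-mono-≤ : x ≤ y → tri x ≤ tri y
tri-mono-≤ {zero}          _         = z≤n
tri-mono-≤ {suc x} {suc y} (s≤s x≤y) = s≤s (+-mono-≤ x≤y (tri-mono-≤ x≤y))

-- z lies on the s-th diagonal, whose first code is tri s.
OnDiagonal : ℕ → ℕ → Set
OnDiagonal s z = tri s ≤ z × z < tri (suc s)

onDiagonal-unique : OnDiagonal x z → OnDiagonal y z → x ≡ y
onDiagonal-unique {x} {z} {y} (x≤ , <x) (y≤ , <y) with <-cmp x y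
... | tri≈ _ x≡y _ = x≡y
... | tri< x<y _ _ = ⊥-elim (<⇒≱ <x (≤-trans (tri-mono-≤ x<y) y≤))
... | tri> _ _ y<x = ⊥-elim (<⇒≱ <y (≤-trans (tri-mono-≤ y<x) x≤))

nextDiagonal : ℕ → ℕ → ℕ
nextDiagonal s z with z <? tri (suc s)
... | yes _ = s
... | no  _ = suc s

diagonal : ℕ → ℕ
diagonal zero    = 0
diagonal (suc z) = nextDiagonal (diagonal z) (suc z)

onDiagonal-diagonal : ∀ z → OnDiagonal (diagonal z) z
onDiagonal-diagonal zero = z≤n , s≤s z≤n
onDiagonal-diagonal (suc z) with onDiagonal-diagonal z
... | s≤z , z<s' with suc z <? tri (suc (diagonal z))
...   | yes z+1<s' = ≤-trans s≤z (n≤1+n z) , z+1<s'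
...   | no  z+1≮s' = ≮⇒≥ z+1≮s' , s≤s (≤-trans z<s' (m≤n+m (tri (suc (diagonal z))) (suc (diagonal z))))

onDiagonal-pair : ∀ x y → OnDiagonal (x + y) (pair x y)
onDiagonal-pair x y =
  m≤m+n _ _ , s≤s (subst (_≤ x + y + tri (x + y)) (+-comm y (tri (x + y))) (+-monoˡ-≤ (tri (x + y)) (m≤n+m y x)))

unpair₂ : ℕ → ℕ
unpair₂ z = z ∸ tri (diagonal z)

unpair₁ : ℕ → ℕ
unpair₁ z = diagonal z ∸ unpair₂ z

unpair₂≤diagonal : ∀ z → unpair₂ z ≤ diagonal z
unpair₂≤diagonal z =
  subst (unpair₂ z ≤_) (m+n∸n≡m (diagonal z) (tri (diagonal z)))
        (∸-monoˡ-≤ (tri (diagonal z)) (≤-pred (proj₂ (onDiagonal-diagonal z))))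

pair-unpair : ∀ z → pair (unpair₁ z) (unpair₂ z) ≡ z
pair-unpair z = begin
    tri (unpair₁ z + unpair₂ z) + unpair₂ z
  ≡⟨ cong (λ d → tri d + unpair₂ z) (m∸n+n≡m (unpair₂≤diagonal z)) ⟩
    tri (diagonal z) + (z ∸ tri (diagonal z))
  ≡⟨ m+[n∸m]≡n (proj₁ (onDiagonal-diagonal z)) ⟩
    z ∎
  where open ≡-Reasoning

diagonal-pair : ∀ x y → diagonal (pair x y) ≡ x + y
diagonal-pair x y = onDiagonal-unique (onDiagonal-diagonal (pair x y)) (onDiagonal-pair x y)

unpair₂-pair : ∀ x y → unpair₂ (pair x y) ≡ y
unpair₂-pair x y rewrite diagonal-pair x y = m+n∸m≡n (tri (x + y)) y

unpair₁-pair : ∀ x y → unpair₁ (pair x y) ≡ x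
unpair₁-pair x y rewrite unpair₂-pair x y | diagonal-pair x y = m+n∸n≡m x y

unpair₂≤ : ∀ z → unpair₂ z ≤ z
unpair₂≤ z = m∸n≤m z (tri (diagonal z))

≤-pair₁ : ∀ x y → x ≤ pair x y
≤-pair₁ x y = ≤-trans (≤-trans (m≤m+n x y) (n≤tri (x + y))) (m≤m+n _ y)
  where
    n≤tri : ∀ n → n ≤ tri n
    n≤tri zero    = z≤n
    n≤tri (suc n) = m≤m+n (suc n) (tri n)

≤-pair₂ : ∀ x y → y ≤ pair x y
≤-pair₂ x y = m≤n+m y _

diagonalᴾ : Program α 1
diagonalᴾ = muᴾ (app₂ monusᴾ (app₁ succᴾ π₁) (app₁ triᴾ (app₁ succᴾ π₀))) (λ { (z ∷ []) → diagonal z })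
                (λ { (z ∷ []) → m≤n⇒m∸n≡0 (proj₂ (onDiagonal-diagonal z)) })
                (λ { (z ∷ []) s s< → m>n⇒m∸n≢0 (s≤s (≤-trans (tri-mono-≤ s<) (proj₁ (onDiagonal-diagonal z)))) })

unpair₂ᴾ : Program α 1
unpair₂ᴾ = app₂ monusᴾ π₀ (app₁ triᴾ diagonalᴾ)
           computes (λ { (z ∷ []) → unpair₂ z })
           by λ { (z ∷ []) → refl }

unpair₁ᴾ : Program α 1
unpair₁ᴾ = app₂ monusᴾ diagonalᴾ unpair₂ᴾ
           computes (λ { (z ∷ []) → unpair₁ z })
           by λ { (z ∷ []) → refl }

-- Sequence numbers

headᶜ : ℕ → ℕ
headᶜ c = unpair₁ (pred c)

tailᶜ : ℕ → ℕ
tailᶜ c = unpair₂ (pred c)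

dropᶜ : ℕ → ℕ → ℕ
dropᶜ zero    c = c
dropᶜ (suc j) c = tailᶜ (dropᶜ j c)

nthᶜ : ℕ → ℕ → ℕ
nthᶜ j c = headᶜ (dropᶜ j c)

countᶜ : ℕ → ℕ → ℕ
countᶜ zero    c = 0
countᶜ (suc j) c = countᶜ j c + sg (dropᶜ j c)

-- A sequence is no longer than its code, so its length is the number of nonempty
-- tails among the first c ones.
lengthᶜ : ℕ → ℕ
lengthᶜ c = countᶜ c c

head₀ : List ℕ → ℕ
head₀ []      = 0
head₀ (x ∷ _) = x

nth : List ℕ → ℕ → ℕ
nth l j = head₀ (drop j l)

headᶜ-⌜⌝ : ∀ l → headᶜ ⌜ l ⌝ ≡ head₀ l
headᶜ-⌜⌝ []      = refl
headᶜ-⌜⌝ (x ∷ l) = unpair₁-pair x ⌜ l ⌝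

tailᶜ-⌜⌝ : ∀ l → tailᶜ ⌜ l ⌝ ≡ ⌜ drop 1 l ⌝
tailᶜ-⌜⌝ []      = refl
tailᶜ-⌜⌝ (x ∷ l) = unpair₂-pair x ⌜ l ⌝

dropᶜ-⌜⌝ : ∀ j l → dropᶜ j ⌜ l ⌝ ≡ ⌜ drop j l ⌝
dropᶜ-⌜⌝ zero    l = refl
dropᶜ-⌜⌝ (suc j) l = begin
    tailᶜ (dropᶜ j ⌜ l ⌝)   ≡⟨ cong tailᶜ (dropᶜ-⌜⌝ j l) ⟩
    tailᶜ ⌜ drop j l ⌝      ≡⟨ tailᶜ-⌜⌝ (drop j l) ⟩
    ⌜ drop 1 (drop j l) ⌝   ≡⟨ cong ⌜_⌝ (drop-drop j 1 l) ⟩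
    ⌜ drop (j + 1) l ⌝      ≡⟨ cong (λ i → ⌜ drop i l ⌝) (+-comm j 1) ⟩
    ⌜ drop (suc j) l ⌝      ∎
  where open ≡-Reasoning

nthᶜ-⌜⌝ : ∀ j l → nthᶜ j ⌜ l ⌝ ≡ nth l j
nthᶜ-⌜⌝ j l = trans (cong headᶜ (dropᶜ-⌜⌝ j l)) (headᶜ-⌜⌝ (drop j l))

sg-⌜⌝ : ∀ l → sg ⌜ l ⌝ ≡ sg (length l)
sg-⌜⌝ []      = refl
sg-⌜⌝ (x ∷ l) = refl

⊓-suc : ∀ j n → j ⊓ n + sg (n ∸ j) ≡ suc j ⊓ n
⊓-suc zero    zero    = refl
⊓-suc zero    (suc n) = refl
⊓-suc (suc j) zero    = refl
⊓-suc (suc j) (suc n) = cong suc (⊓-suc j n)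

countᶜ-⌜⌝ : ∀ j l → countᶜ j ⌜ l ⌝ ≡ j ⊓ length l
countᶜ-⌜⌝ zero    l = refl
countᶜ-⌜⌝ (suc j) l = begin
    countᶜ j ⌜ l ⌝ + sg (dropᶜ j ⌜ l ⌝)      ≡⟨ cong₂ _+_ (countᶜ-⌜⌝ j l) (cong sg (dropᶜ-⌜⌝ j l)) ⟩
    j ⊓ length l + sg ⌜ drop j l ⌝          ≡⟨ cong (λ t → j ⊓ length l + t) (sg-⌜⌝ (drop j l)) ⟩
    j ⊓ length l + sg (length (drop j l))   ≡⟨ cong (λ t → j ⊓ length l + sg t) (length-drop j l) ⟩
    j ⊓ length l + sg (length l ∸ j)        ≡⟨ ⊓-suc j (length l) ⟩
    suc j ⊓ length l                        ∎
  where open ≡-Reasoning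

length≤⌜⌝ : ∀ l → length l ≤ ⌜ l ⌝
length≤⌜⌝ []      = z≤n
length≤⌜⌝ (x ∷ l) = s≤s (≤-trans (length≤⌜⌝ l) (≤-pair₂ x ⌜ l ⌝))

lengthᶜ-⌜⌝ : ∀ l → lengthᶜ ⌜ l ⌝ ≡ length l
lengthᶜ-⌜⌝ l = trans (countᶜ-⌜⌝ ⌜ l ⌝ l) (m≥n⇒m⊓n≡n (length≤⌜⌝ l))

-- The fuel k ≥ c suffices since both components of a pair are bounded by it.
decodeWithin : ℕ → ℕ → List ℕ
decodeWithin zero    c       = []
decodeWithin (suc k) zero    = []
decodeWithin (suc k) (suc z) = unpair₁ z ∷ decodeWithin k (unpair₂ z)

decode : ℕ → List ℕ
decode c = decodeWithin c c

⌜decodeWithin⌝ : ∀ k c → c ≤ k → ⌜ decodeWithin k c ⌝ ≡ c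
⌜decodeWithin⌝ zero    zero    _         = refl
⌜decodeWithin⌝ (suc k) zero    _         = refl
⌜decodeWithin⌝ (suc k) (suc z) (s≤s z≤k) =
  cong suc (trans (cong (pair (unpair₁ z)) (⌜decodeWithin⌝ k (unpair₂ z) (≤-trans (unpair₂≤ z) z≤k)))
                  (pair-unpair z))

⌜decode⌝ : ∀ c → ⌜ decode c ⌝ ≡ c
⌜decode⌝ c = ⌜decodeWithin⌝ c c ≤-refl

decodeWithin-⌜⌝ : ∀ k l → ⌜ l ⌝ ≤ k → decodeWithin k ⌜ l ⌝ ≡ l
decodeWithin-⌜⌝ zero    []      _         = refl
decodeWithin-⌜⌝ (suc k) []      _         = refl
decodeWithin-⌜⌝ (suc k) (x ∷ l) (s≤s c≤k) rewrite unpair₁-pair x ⌜ l ⌝ | unpair₂-pair x ⌜ l ⌝ =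
  cong (x ∷_) (decodeWithin-⌜⌝ k l (≤-trans (≤-pair₂ x ⌜ l ⌝) c≤k))

decode-⌜⌝ : ∀ l → decode ⌜ l ⌝ ≡ l
decode-⌜⌝ l = decodeWithin-⌜⌝ ⌜ l ⌝ l ≤-refl

lengthᶜ≡length∘decode : ∀ c → lengthᶜ c ≡ length (decode c)
lengthᶜ≡length∘decode c = trans (cong lengthᶜ (sym (⌜decode⌝ c))) (lengthᶜ-⌜⌝ (decode c))

nthᶜ≡nth∘decode : ∀ j c → nthᶜ j c ≡ nth (decode c) j
nthᶜ≡nth∘decode j c = trans (cong (nthᶜ j) (sym (⌜decode⌝ c))) (nthᶜ-⌜⌝ j (decode c))

nth-map : ∀ (f : ℕ → ℕ) l {j} → j < length l → nth (List.map f l) j ≡ f (nth l j)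
nth-map f (x ∷ l) {zero}  _         = refl
nth-map f (x ∷ l) {suc j} (s≤s j<l) = nth-map f l j<l

nth-++ˡ : ∀ σ τ {j} → j < length σ → nth (σ ++ τ) j ≡ nth σ j
nth-++ˡ (x ∷ σ) τ {zero}  _         = refl
nth-++ˡ (x ∷ σ) τ {suc j} (s≤s j<σ) = nth-++ˡ σ τ j<σ

nth-++-length : ∀ σ x → nth (σ ++ x ∷ []) (length σ) ≡ x
nth-++-length []      x = refl
nth-++-length (y ∷ σ) x = nth-++-length σ x

≡-by-nth : ∀ l l' → length l ≡ length l' → (∀ j → j < length l → nth l j ≡ nth l' j) → l ≡ l'
≡-by-nth []      []        _   _    = refl
≡-by-nth (x ∷ l) (x' ∷ l') len same =
  cong₂ _∷_ (same 0 z<s) (≡-by-nth l l' (suc-injective len) (λ j j< → same (suc j) (s≤s j<)))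

length-↾ : ∀ q n → length (q ↾ n) ≡ n
length-↾ q zero    = refl
length-↾ q (suc n) = trans (length-++ (q ↾ n)) (trans (+-comm (length (q ↾ n)) 1) (cong suc (length-↾ q n)))

nth-↾ : ∀ q n {j} → j < n → nth (q ↾ n) j ≡ q j
nth-↾ q (suc n) {j} j<1+n with m≤n⇒m<n∨m≡n (≤-pred j<1+n)
... | inj₁ j<n  = trans (nth-++ˡ (q ↾ n) (q n ∷ []) (subst (j <_) (sym (length-↾ q n)) j<n)) (nth-↾ q n j<n)
... | inj₂ refl = trans (cong (nth ((q ↾ j) ++ q j ∷ [])) (sym (length-↾ q j))) (nth-++-length (q ↾ j) (q j))

-- Tuples of the wrong length are padded with zeros or truncated.
vecOf : ∀ n → List ℕ → Vec ℕ n
vecOf zero    l       = []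
vecOf (suc n) []      = 0 ∷ vecOf n []
vecOf (suc n) (x ∷ l) = x ∷ vecOf n l

toList-vecOf : ∀ {n} l → length l ≡ n → toList (vecOf n l) ≡ l
toList-vecOf []      refl = refl
toList-vecOf (x ∷ l) refl = cong (x ∷_) (toList-vecOf l refl)

vecOf-toList : (xs : Vec ℕ n) → vecOf n (toList xs) ≡ xs
vecOf-toList []       = refl
vecOf-toList (x ∷ xs) = cong (x ∷_) (vecOf-toList xs)

-- A sequence number bounds every entry of the sequence.
map-cong-≤⌜⌝ : ∀ {f f' : ℕ → ℕ} (xs : Vec ℕ n) → (∀ x → x ≤ ⌜ toList xs ⌝ → f x ≡ f' x) →
               Vec.map f xs ≡ Vec.map f' xs
map-cong-≤⌜⌝ []       _    = refl
map-cong-≤⌜⌝ (x ∷ xs) same =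
  cong₂ _∷_ (same x (≤-trans (≤-pair₁ x _) (n≤1+n _)))
            (map-cong-≤⌜⌝ xs (λ y y≤ → same y (≤-trans y≤ (≤-trans (≤-pair₂ x _) (n≤1+n _)))))

IsImage : (ℕ → ℕ) → ℕ → ℕ → ℕ → Set
IsImage f n c c' = lengthᶜ c ≡ n × lengthᶜ c' ≡ n × (∀ j → j < lengthᶜ c → nthᶜ j c' ≡ f (nthᶜ j c))

isImage-⌜⌝ : ∀ f (xs : Vec ℕ n) → IsImage f n ⌜ toList xs ⌝ ⌜ toList (Vec.map f xs) ⌝
isImage-⌜⌝ {n} f xs = length-xs , trans (lengthᶜ-⌜⌝ (toList (Vec.map f xs))) (length-toList (Vec.map f xs)) , entries
  where
    length-xs : lengthᶜ ⌜ toList xs ⌝ ≡ n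
    length-xs = trans (lengthᶜ-⌜⌝ (toList xs)) (length-toList xs)
    entries : ∀ j → j < lengthᶜ ⌜ toList xs ⌝ → nthᶜ j ⌜ toList (Vec.map f xs) ⌝ ≡ f (nthᶜ j ⌜ toList xs ⌝)
    entries j j< = begin
      nthᶜ j ⌜ toList (Vec.map f xs) ⌝   ≡⟨ nthᶜ-⌜⌝ j _ ⟩
      nth (toList (Vec.map f xs)) j      ≡⟨ cong (λ l → nth l j) (toList-map f xs) ⟩
      nth (List.map f (toList xs)) j     ≡⟨ nth-map f (toList xs) (subst (j <_) (trans length-xs (sym (length-toList xs))) j<) ⟩
      f (nth (toList xs) j)              ≡⟨ cong f (nthᶜ-⌜⌝ j _) ⟨
      f (nthᶜ j ⌜ toList xs ⌝)           ∎
      where open ≡-Reasoning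

vecOf-decode-⌜⌝ : (xs : Vec ℕ n) → vecOf n (decode ⌜ toList xs ⌝) ≡ xs
vecOf-decode-⌜⌝ {n} xs = trans (cong (vecOf n) (decode-⌜⌝ (toList xs))) (vecOf-toList xs)

toList-vecOf-decode : ∀ c → lengthᶜ c ≡ n → toList (vecOf n (decode c)) ≡ decode c
toList-vecOf-decode c len = toList-vecOf (decode c) (trans (sym (lengthᶜ≡length∘decode c)) len)

decode-isImage : ∀ {f c c'} → IsImage f n c c' → decode c' ≡ toList (Vec.map f (vecOf n (decode c)))
decode-isImage {n} {f} {c} {c'} (len , len' , entries) =
  ≡-by-nth (decode c') (toList (Vec.map f (vecOf n (decode c))))
    (trans (sym (lengthᶜ≡length∘decode c')) (trans len' (sym (length-toList (Vec.map f (vecOf n (decode c)))))))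
    entry
  where
    entry : ∀ j → j < length (decode c') → nth (decode c') j ≡ nth (toList (Vec.map f (vecOf n (decode c)))) j
    entry j j< = begin
      nth (decode c') j                                   ≡⟨ nthᶜ≡nth∘decode j c' ⟨
      nthᶜ j c'                                           ≡⟨ entries j j<c ⟩
      f (nthᶜ j c)                                        ≡⟨ cong f (nthᶜ≡nth∘decode j c) ⟩
      f (nth (decode c) j)                                ≡⟨ nth-map f (decode c) (subst (j <_) (lengthᶜ≡length∘decode c) j<c) ⟨
      nth (List.map f (decode c)) j                       ≡⟨ cong (λ l → nth (List.map f l) j) (toList-vecOf-decode c len) ⟨
      nth (List.map f (toList (vecOf n (decode c)))) j    ≡⟨ cong (λ l → nth l j) (toList-map f (vecOf n (decode c))) ⟨
      nth (toList (Vec.map f (vecOf n (decode c)))) j     ∎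
      where
        open ≡-Reasoning
        j<c : j < lengthᶜ c
        j<c = subst (j <_) (trans (sym (lengthᶜ≡length∘decode c')) (trans len' (sym len))) j<

headᴾ : Program α 1
headᴾ = app₁ unpair₁ᴾ predᴾ computes (λ { (c ∷ []) → headᶜ c }) by λ { (c ∷ []) → refl }

tailᴾ : Program α 1
tailᴾ = app₁ unpair₂ᴾ predᴾ computes (λ { (c ∷ []) → tailᶜ c }) by λ { (c ∷ []) → refl }

dropᴾ : Program α 2
dropᴾ {α} = precᴾ π₀ (app₁ tailᴾ π₁)
            computes (λ { (j ∷ c ∷ []) → dropᶜ j c })
            by λ { (j ∷ c ∷ []) → drops j c }
  where
    drops : ∀ j c → ⟦ precᴾ {α = α} π₀ (app₁ tailᴾ π₁) ⟧ (j ∷ c ∷ []) ≡ dropᶜ j c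
    drops zero    c = refl
    drops (suc j) c = cong tailᶜ (drops j c)

nthᴾ : Program α 2
nthᴾ = app₁ headᴾ dropᴾ computes (λ { (j ∷ c ∷ []) → nthᶜ j c }) by λ { (j ∷ c ∷ []) → refl }

lengthᴾ : Program α 1
lengthᴾ {α} = app₂ countᴾ π₀ π₀ computes (λ { (c ∷ []) → lengthᶜ c }) by λ { (c ∷ []) → counts c c }
  where
    countᴾ : Program α 2
    countᴾ = precᴾ zeroᴾ (app₂ addᴾ π₁ (app₁ sgᴾ (app₂ dropᴾ π₀ π₂)))
    counts : ∀ j c → ⟦ countᴾ ⟧ (j ∷ c ∷ []) ≡ countᶜ j c
    counts zero    c = refl
    counts (suc j) c = cong (_+ sg (dropᶜ j c)) (counts j c)

-- Turing reducibility

mutual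
  substOracle : Code 1 → Code k → Code k
  substOracle d zer         = zer
  substOracle d succ        = succ
  substOracle d (proj i)    = proj i
  substOracle d orc         = d
  substOracle d (comp f gs) = comp (substOracle d f) (substOracleAll d gs)
  substOracle d (prec g h)  = prec (substOracle d g) (substOracle d h)
  substOracle d (mu g)      = mu (substOracle d g)

  substOracleAll : Code 1 → Vec (Code k) m → Vec (Code k) m
  substOracleAll d []       = []
  substOracleAll d (g ∷ gs) = substOracle d g ∷ substOracleAll d gs

module _ {α β : ℕ → ℕ} (d : Code 1) (d-computes : ∀ n → Eval α d (n ∷ []) (β n)) where
  mutual
    eval-substOracle : ∀ {c : Code k} {xs y} → Eval β c xs y → Eval α (substOracle d c) xs y
    eval-substOracle e-zer          = e-zer
    eval-substOracle e-succ         = e-succ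
    eval-substOracle e-proj         = e-proj
    eval-substOracle (e-orc {x})    = d-computes x
    eval-substOracle (e-comp es e)  = e-comp (evalAll-substOracle es) (eval-substOracle e)
    eval-substOracle (e-prec0 e)    = e-prec0 (eval-substOracle e)
    eval-substOracle (e-precS e e') = e-precS (eval-substOracle e) (eval-substOracle e')
    eval-substOracle (e-mu e below) =
      e-mu (eval-substOracle e) (λ z z< → proj₁ (below z z<) , eval-substOracle (proj₂ (below z z<)))

    evalAll-substOracle : ∀ {gs : Vec (Code k) m} {xs ys} → EvalAll β gs xs ys → EvalAll α (substOracleAll d gs) xs ys
    evalAll-substOracle []       = []
    evalAll-substOracle (e ∷ es) = eval-substOracle e ∷ evalAll-substOracle es

≤T-refl : ∀ f → f ≤T f
≤T-refl f = orc , λ n → e-orc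

≤T-trans : ∀ {f g h} → f ≤T g → g ≤T h → f ≤T h
≤T-trans (c , c-computes) (d , d-computes) = substOracle d c , λ n → eval-substOracle d d-computes (c-computes n)

programFor : ∀ {f} → f ≤T α → Program α 1
programFor {f = f} (c , c-computes) = program c (λ { (x ∷ []) → f x }) (λ { (x ∷ []) → c-computes x })

≤T-by : ∀ (P : Program α 1) f → (∀ x → ⟦ P ⟧ (x ∷ []) ≡ f x) → f ≤T α
≤T-by {α} P f eq = code P , λ x → subst (Eval α (code P) (x ∷ [])) (eq x) (eval P (x ∷ []))

∘-≤T : ∀ {f g} → f ≤T α → g ≤T α → (f ∘ g) ≤T α
∘-≤T f≤α g≤α = ≤T-by (app₁ (programFor f≤α) (programFor g≤α)) _ (λ x → refl)

module _ {f : ℕ → ℕ} (f-injective : ∀ x y → f x ≡ f y → x ≡ y) (f-surjective : ∀ y → ∃[ x ] f x ≡ y) where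

  inverse : ℕ → ℕ
  inverse y = proj₁ (f-surjective y)

  f∘inverse : ∀ y → f (inverse y) ≡ y
  f∘inverse y = proj₂ (f-surjective y)

  inverse∘f : ∀ x → inverse (f x) ≡ x
  inverse∘f x = f-injective _ _ (f∘inverse (f x))

  -- The inverse searches for the least preimage, which is the only one.
  inverse-≤T : f ≤T α → inverse ≤T α
  inverse-≤T f≤α =
    ≤T-by (muᴾ (app₂ distᴾ (app₁ (programFor f≤α) π₀) π₁) (λ { (y ∷ []) → inverse y })
               (λ { (y ∷ []) → m≡n⇒∣m-n∣≡0 (f∘inverse y) })
               (λ { (y ∷ []) x x< ∣fx-y∣≡0 →
                      <⇒≢ x< (f-injective _ _ (trans (∣m-n∣≡0⇒m≡n ∣fx-y∣≡0) (sym (f∘inverse y)))) }))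
          inverse (λ x → refl)

evens : (ℕ → ℕ) → ℕ → ℕ
evens q x = q (x + x)

odds : (ℕ → ℕ) → ℕ → ℕ
odds q x = q (suc (x + x))

evens-≤T : ∀ q → evens q ≤T q
evens-≤T q = ∘-≤T (≤T-refl q) (≤T-by doubleᴾ (λ x → x + x) (λ x → refl))

parityₙ : ℕ → ℕ
parityₙ zero    = 0
parityₙ (suc n) = 1 ∸ parityₙ n

half : ℕ → ℕ
half zero    = 0
half (suc n) = half n + parityₙ n

parityₙ-even : ∀ x → parityₙ (x + x) ≡ 0
parityₙ-even zero    = refl
parityₙ-even (suc x) rewrite +-suc x x | parityₙ-even x = refl

half-even : ∀ x → half (x + x) ≡ x
half-even zero    = refl
half-even (suc x) rewrite +-suc x x | parityₙ-even x | half-even x = trans (cong (_+ 1) (+-identityʳ x)) (+-comm x 1)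

parityᴾ : Program α 1
parityᴾ {α} = P computes (λ { (n ∷ []) → parityₙ n }) by λ { (n ∷ []) → parities n }
  where
    P : Program α 1
    P = precᴾ zeroᴾ (app₂ monusᴾ (constᴾ 1) π₁)
    parities : ∀ n → ⟦ P ⟧ (n ∷ []) ≡ parityₙ n
    parities zero    = refl
    parities (suc n) = cong (1 ∸_) (parities n)

halfᴾ : Program α 1
halfᴾ {α} = P computes (λ { (n ∷ []) → half n }) by λ { (n ∷ []) → halves n }
  where
    P : Program α 1
    P = precᴾ zeroᴾ (app₂ addᴾ π₁ (app₁ parityᴾ π₀))
    halves : ∀ n → ⟦ P ⟧ (n ∷ []) ≡ half n
    halves zero    = refl
    halves (suc n) = cong (_+ parityₙ n) (halves n)

interleave : (ℕ → ℕ) → (ℕ → ℕ) → ℕ → ℕ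
interleave f g n = ifz (parityₙ n) (f (half n)) (g (half n))

evens-interleave : ∀ f g x → evens (interleave f g) x ≡ f x
evens-interleave f g x rewrite parityₙ-even x | half-even x = refl

odds-interleave : ∀ f g x → odds (interleave f g) x ≡ g x
odds-interleave f g x rewrite parityₙ-even x | half-even x = cong g (+-identityʳ x)

interleave-≤T : ∀ {f g} → f ≤T α → g ≤T α → interleave f g ≤T α
interleave-≤T f≤α g≤α =
  ≤T-by (app₃ ifzᴾ parityᴾ (app₁ (programFor f≤α) halfᴾ) (app₁ (programFor g≤α) halfᴾ)) _ (λ x → refl)

-- Isomorphisms

private
  variable
    ar : Vocab
    A B C : Structure ar

record Iso (ar : Vocab) (A B : Structure ar) : Set where
  constructor mkIso
  field
    to    : ℕ → ℕ
    isIso : IsIso ar A B to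

  injective : ∀ x y → to x ≡ to y → x ≡ y
  injective = proj₁ isIso

  surjective : ∀ y → ∃[ x ] to x ≡ y
  surjective = proj₁ (proj₂ isIso)

  preserves : ∀ i (xs : Vec ℕ (ar i)) → A i xs ≡ B i (Vec.map to xs)
  preserves = proj₂ (proj₂ isIso)

  from : ℕ → ℕ
  from = inverse injective surjective

  to∘from : ∀ y → to (from y) ≡ y
  to∘from = f∘inverse injective surjective

  from∘to : ∀ x → from (to x) ≡ x
  from∘to = inverse∘f injective surjective

  from-≤T : to ≤T α → from ≤T α
  from-≤T = inverse-≤T injective surjective

Iso-sym : Iso ar A B → Iso ar B A
Iso-sym {A = A} {B = B} i = mkIso from
  ((λ x y eq → trans (sym (to∘from x)) (trans (cong to eq) (to∘from y))) ,
   (λ x → to x , from∘to x) ,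
   (λ j ys → sym (trans (preserves j (Vec.map from ys)) (cong (B j) map-to∘from))))
  where
    open Iso i
    map-to∘from : ∀ {n} {ys : Vec ℕ n} → Vec.map to (Vec.map from ys) ≡ ys
    map-to∘from {ys = ys} = begin
      Vec.map to (Vec.map from ys)   ≡⟨ map-∘ to from ys ⟨
      Vec.map (to ∘ from) ys         ≡⟨ map-cong to∘from ys ⟩
      Vec.map (λ y → y) ys           ≡⟨ map-id ys ⟩
      ys                             ∎
      where open ≡-Reasoning

Iso-trans : Iso ar A B → Iso ar B C → Iso ar A C
Iso-trans {C = C} (mkIso f (f-injective , f-surjective , f-preserves)) (mkIso g (g-injective , g-surjective , g-preserves)) =
  mkIso (g ∘ f)
    ((λ x y eq → f-injective x y (g-injective (f x) (f y) eq)) ,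
     (λ z → let (y , gy≡z) = g-surjective z ; (x , fx≡y) = f-surjective y in x , trans (cong g fx≡y) gy≡z) ,
     (λ i xs → trans (f-preserves i xs) (trans (g-preserves i (Vec.map f xs)) (cong (C i) (sym (map-∘ g f xs))))))

copies-iso-≤T : ∀ {X A₀ A₁} → InCatSpec ar A X →
                ComputableStructure ar A₀ → (∃[ h ] IsIso ar A A₀ h) →
                ComputableStructure ar A₁ → (∃[ h ] IsIso ar A A₁ h) →
                Σ (Iso ar A₀ A₁) λ i → Iso.to i ≤T X
copies-iso-≤T {A = A} {A₀ = A₀} X∈CatSpec A₀ᶜ A≅A₀ A₁ᶜ A≅A₁
  with X∈CatSpec _ A₀ᶜ A≅A₀ | X∈CatSpec _ A₁ᶜ A≅A₁
... | h₀ , h₀-iso , h₀≤X | h₁ , h₁-iso , h₁≤X =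
  Iso-trans (Iso-sym A≅ᵢA₀) (mkIso h₁ h₁-iso) , ∘-≤T h₁≤X (Iso.from-≤T A≅ᵢA₀ h₀≤X)
  where
    A≅ᵢA₀ : Iso _ A A₀
    A≅ᵢA₀ = mkIso h₀ h₀-iso

eval-diagram : ∀ {ar A} ((d , d-computes) : ComputableStructure ar A) {i c} → lengthᶜ c ≡ ar i →
               Eval ∅ d (i ∷ c ∷ []) (b2n (A i (vecOf (ar i) (decode c))))
eval-diagram {ar} {A} (d , d-computes) {i} {c} len =
  subst (λ c' → Eval ∅ d (i ∷ c' ∷ []) (b2n (A i (vecOf (ar i) (decode c)))))
        (trans (cong ⌜_⌝ (toList-vecOf-decode c len)) (⌜decode⌝ c))
        (d-computes i (vecOf (ar i) (decode c)))

-- The tree of isomorphisms together with their inverses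

module IsoTree {ar : Vocab} (A₀ A₁ : Structure ar) where

  -- g is read as the pair (evens g, odds g) of candidate isomorphism and inverse;
  -- only the part below L is constrained.
  InverseˡBelow : ℕ → (ℕ → ℕ) → Set
  InverseˡBelow L g = ∀ x → x + x < L → suc (evens g x + evens g x) < L → odds g (evens g x) ≡ x

  InverseʳBelow : ℕ → (ℕ → ℕ) → Set
  InverseʳBelow L g = ∀ y → suc (y + y) < L → odds g y + odds g y < L → evens g (odds g y) ≡ y

  PreservesBelow : ℕ → (ℕ → ℕ) → Set
  PreservesBelow L g = ∀ i (xs : Vec ℕ (ar i)) → i < L → ⌜ toList xs ⌝ + ⌜ toList xs ⌝ < L →
                       ⌜ toList (Vec.map (evens g) xs) ⌝ < L → A₀ i xs ≡ A₁ i (Vec.map (evens g) xs)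

  record Consistent (L : ℕ) (g : ℕ → ℕ) : Set where
    constructor consistent
    field
      inverseˡ  : InverseˡBelow L g
      inverseʳ  : InverseʳBelow L g
      preserves : PreservesBelow L g
  open Consistent

  Consistent-mono : ∀ {L L' g} → L ≤ L' → Consistent L' g → Consistent L g
  Consistent-mono L≤L' c = record
    { inverseˡ  = λ x x< y< → inverseˡ c x (<-≤-trans x< L≤L') (<-≤-trans y< L≤L')
    ; inverseʳ  = λ y y< x< → inverseʳ c y (<-≤-trans y< L≤L') (<-≤-trans x< L≤L')
    ; preserves = λ i xs i< xs< ys< → preserves c i xs (<-≤-trans i< L≤L') (<-≤-trans xs< L≤L') (<-≤-trans ys< L≤L')
    }

  Consistent-cong : ∀ {L g g'} → (∀ j → j < L → g j ≡ g' j) → Consistent L g → Consistent L g'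
  Consistent-cong {L} {g} {g'} g≡g' c = record { inverseˡ = invˡ ; inverseʳ = invʳ ; preserves = pres }
    where
      invˡ : InverseˡBelow L g'
      invˡ x x< y< rewrite sym (g≡g' (x + x) x<) | sym (g≡g' _ y<) = inverseˡ c x x< y<
      invʳ : InverseʳBelow L g'
      invʳ y y< x< rewrite sym (g≡g' (suc (y + y)) y<) | sym (g≡g' _ x<) = inverseʳ c y y< x<
      same-image : ∀ {n} (xs : Vec ℕ n) → ⌜ toList xs ⌝ + ⌜ toList xs ⌝ < L →
                   Vec.map (evens g) xs ≡ Vec.map (evens g') xs
      same-image xs xs< = map-cong-≤⌜⌝ xs (λ x x≤ → g≡g' (x + x) (≤-<-trans (+-mono-≤ x≤ x≤) xs<))
      pres : PreservesBelow L g'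
      pres i xs i< xs< ys< rewrite sym (same-image xs xs<) = preserves c i xs i< xs< ys<

  evensᶜ : ℕ → ℕ → ℕ
  evensᶜ s = evens (λ j → nthᶜ j s)

  oddsᶜ : ℕ → ℕ → ℕ
  oddsᶜ s = odds (λ j → nthᶜ j s)

  inverseˡₙ : ℕ → ℕ → ℕ
  inverseˡₙ L s = all< (λ x → impₙ (andₙ (L ∸ (x + x)) (L ∸ suc (evensᶜ s x + evensᶜ s x)))
                                   (eqₙ (oddsᶜ s (evensᶜ s x)) x)) L

  inverseʳₙ : ℕ → ℕ → ℕ
  inverseʳₙ L s = all< (λ y → impₙ (andₙ (L ∸ suc (y + y)) (L ∸ (oddsᶜ s y + oddsᶜ s y)))
                                   (eqₙ (evensᶜ s (oddsᶜ s y)) y)) L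

  -- Every entry x of the tuple coded by c is at most c, so c + c < L keeps the entries
  -- of s at 2x within the sequence.
  imageₙ : ℕ → ℕ → ℕ → ℕ → ℕ → ℕ
  imageₙ L s i c c' = andₙ (L ∸ (c + c)) (andₙ (eqₙ (lengthᶜ c) (ar i)) (andₙ (eqₙ (lengthᶜ c') (ar i))
                        (all< (λ j → eqₙ (nthᶜ j c') (evensᶜ s (nthᶜ j c))) (lengthᶜ c))))

  agreeₙ : ℕ → ℕ → ℕ → ℕ
  agreeₙ i c c' = eqₙ (b2n (A₀ i (vecOf (ar i) (decode c)))) (b2n (A₁ i (vecOf (ar i) (decode c'))))

  preservesₙ : ℕ → ℕ → ℕ
  preservesₙ L s = all< (λ i → all< (λ c → all< (λ c' → impₙ (imageₙ L s i c c') (agreeₙ i c c')) L) L) L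

  consistentₙ : ℕ → ℕ → ℕ
  consistentₙ L s = andₙ (inverseˡₙ L s) (andₙ (inverseʳₙ L s) (preservesₙ L s))

  tree : List ℕ → Bool
  tree σ = nonzero (sg (consistentₙ (lengthᶜ ⌜ σ ⌝) ⌜ σ ⌝))

  bounds-pos : ∀ {L a b} → 0 < andₙ (L ∸ a) (L ∸ b) ⇔ (a < L × b < L)
  bounds-pos = mk⇔ (λ h → let (a , b) = forward and-pos h in forward ∸-pos a , forward ∸-pos b)
                   (λ (a< , b<) → backward and-pos (backward ∸-pos a< , backward ∸-pos b<))

  inverseˡₙ-pos : ∀ {L s} → 0 < inverseˡₙ L s ⇔ InverseˡBelow L (λ j → nthᶜ j s)
  inverseˡₙ-pos {L} = mk⇔
    (λ h x x< y< → forward eq-pos (forward imp-pos (forward all-pos h x (≤-<-trans (m≤m+n x x) x<))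
                                                   (backward bounds-pos (x< , y<))))
    (λ h → backward (all-pos {n = L}) λ x _ → backward imp-pos λ bounds →
             let (x< , y<) = forward bounds-pos bounds in backward eq-pos (h x x< y<))

  inverseʳₙ-pos : ∀ {L s} → 0 < inverseʳₙ L s ⇔ InverseʳBelow L (λ j → nthᶜ j s)
  inverseʳₙ-pos {L} = mk⇔
    (λ h y y< x< → forward eq-pos (forward imp-pos (forward all-pos h y (≤-<-trans (≤-trans (m≤m+n y y) (n≤1+n _)) y<))
                                                   (backward bounds-pos (y< , x<))))
    (λ h → backward (all-pos {n = L}) λ y _ → backward imp-pos λ bounds →
             let (y< , x<) = forward bounds-pos bounds in backward eq-pos (h y y< x<))

  imageₙ-pos : ∀ {L s i c c'} → 0 < imageₙ L s i c c' ⇔ (c + c < L × IsImage (evensᶜ s) (ar i) c c')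
  imageₙ-pos {c = c} = mk⇔
    (λ h → let (c< , h₁) = forward and-pos h ; (len , h₂) = forward and-pos h₁ ; (len' , entries) = forward and-pos h₂ in
           forward ∸-pos c< , forward eq-pos len , forward eq-pos len' , λ j j< → forward eq-pos (forward all-pos entries j j<))
    (λ (c< , len , len' , entries) →
           backward and-pos (backward ∸-pos c< , backward and-pos (backward eq-pos len , backward and-pos (backward eq-pos len' ,
             backward (all-pos {n = lengthᶜ c}) λ j j< → backward eq-pos (entries j j<)))))

  agreeₙ-pos : ∀ {i c c'} → 0 < agreeₙ i c c' ⇔ A₀ i (vecOf (ar i) (decode c)) ≡ A₁ i (vecOf (ar i) (decode c'))
  agreeₙ-pos = mk⇔ (b2n-injective ∘ forward eq-pos) (backward eq-pos ∘ cong b2n)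

  preservesₙ-pos : ∀ {L s} → 0 < preservesₙ L s ⇔ PreservesBelow L (λ j → nthᶜ j s)
  preservesₙ-pos {L} {s} = mk⇔ preserved checked
    where
      preserved : 0 < preservesₙ L s → PreservesBelow L (λ j → nthᶜ j s)
      preserved h i xs i< xs< ys< =
        subst₂ (λ us vs → A₀ i us ≡ A₁ i vs) (vecOf-decode-⌜⌝ xs) (vecOf-decode-⌜⌝ (Vec.map (evensᶜ s) xs))
               (forward agreeₙ-pos (forward imp-pos
                 (forward all-pos (forward all-pos (forward all-pos h i i<) ⌜ toList xs ⌝ (≤-<-trans (m≤m+n _ _) xs<))
                                  ⌜ toList (Vec.map (evensᶜ s) xs) ⌝ ys<)
                 (backward imageₙ-pos (xs< , isImage-⌜⌝ (evensᶜ s) xs))))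
      agree : PreservesBelow L (λ j → nthᶜ j s) →
              ∀ i c c' → i < L → c' < L → c + c < L × IsImage (evensᶜ s) (ar i) c c' →
              A₀ i (vecOf (ar i) (decode c)) ≡ A₁ i (vecOf (ar i) (decode c'))
      agree h i c c' i< c'< (c+c< , image@(len , _ , _)) =
        trans (h i xs i< (subst (λ t → t + t < L) (sym ⌜xs⌝≡c) c+c<) (subst (_< L) (sym ⌜ys⌝≡c') c'<))
              (cong (A₁ i) (sym (trans (cong (vecOf (ar i)) decode-c') (vecOf-toList _))))
        where
          xs : Vec ℕ (ar i)
          xs = vecOf (ar i) (decode c)
          decode-c' : decode c' ≡ toList (Vec.map (evensᶜ s) xs)
          decode-c' = decode-isImage image
          ⌜xs⌝≡c : ⌜ toList xs ⌝ ≡ c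
          ⌜xs⌝≡c = trans (cong ⌜_⌝ (toList-vecOf-decode c len)) (⌜decode⌝ c)
          ⌜ys⌝≡c' : ⌜ toList (Vec.map (evensᶜ s) xs) ⌝ ≡ c'
          ⌜ys⌝≡c' = trans (cong ⌜_⌝ (sym decode-c')) (⌜decode⌝ c')
      checked : PreservesBelow L (λ j → nthᶜ j s) → 0 < preservesₙ L s
      checked h = backward (all-pos {n = L}) λ i i< → backward (all-pos {n = L}) λ c _ → backward (all-pos {n = L}) λ c' c'< →
                    backward imp-pos λ image → backward agreeₙ-pos (agree h i c c' i< c'< (forward imageₙ-pos image))

  Consistent-length : ∀ {L L' g} → L ≡ L' → Consistent L g ⇔ Consistent L' g
  Consistent-length refl = mk⇔ (λ c → c) (λ c → c)

  consistentₙ-pos : ∀ {L s} → 0 < consistentₙ L s ⇔ Consistent L (λ j → nthᶜ j s)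
  consistentₙ-pos = mk⇔
    (λ h → let (invˡ , h') = forward and-pos h ; (invʳ , pres) = forward and-pos h' in
           consistent (forward inverseˡₙ-pos invˡ) (forward inverseʳₙ-pos invʳ) (forward preservesₙ-pos pres))
    (λ (consistent invˡ invʳ pres) →
           backward and-pos (backward inverseˡₙ-pos invˡ ,
                             backward and-pos (backward inverseʳₙ-pos invʳ , backward preservesₙ-pos pres)))

  tree-accepts : ∀ σ → tree σ ≡ true ⇔ Consistent (length σ) (nth σ)
  tree-accepts σ = ⇔.trans nonzero-true (⇔.trans sg-pos (⇔.trans consistentₙ-pos decoded))
    where
      decoded : Consistent (lengthᶜ ⌜ σ ⌝) (λ j → nthᶜ j ⌜ σ ⌝) ⇔ Consistent (length σ) (nth σ)
      decoded = ⇔.trans (mk⇔ (Consistent-cong (λ j _ → nthᶜ-⌜⌝ j σ))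
                             (Consistent-cong (λ j _ → sym (nthᶜ-⌜⌝ j σ))))
                        (Consistent-length (lengthᶜ-⌜⌝ σ))

  tree-prefixClosed : ∀ σ τ → tree (σ ++ τ) ≡ true → tree σ ≡ true
  tree-prefixClosed σ τ accepted =
    backward (tree-accepts σ)
      (Consistent-cong (λ j j< → nth-++ˡ σ τ j<)
        (Consistent-mono (subst (length σ ≤_) (sym (length-++ σ)) (m≤m+n _ _)) (forward (tree-accepts (σ ++ τ)) accepted)))

  isPath⇔consistent : ∀ q → IsPath tree q ⇔ (∀ n → Consistent n q)
  isPath⇔consistent q = mk⇔ (λ path n → prefix⇔ n .forward (path n)) (λ c n → prefix⇔ n .backward (c n))
    where
      prefix⇔ : ∀ n → tree (q ↾ n) ≡ true ⇔ Consistent n q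
      prefix⇔ n = ⇔.trans (tree-accepts (q ↾ n)) (⇔.trans (Consistent-length (length-↾ q n))
                    (mk⇔ (Consistent-cong (λ j → nth-↾ q n)) (Consistent-cong (λ j j< → sym (nth-↾ q n j<)))))

  evens-isIso : ∀ {q} → IsPath tree q → IsIso ar A₀ A₁ (evens q)
  evens-isIso {q} path =
    (λ x x' eq → trans (sym (odds∘evens x)) (trans (cong (odds q) eq) (odds∘evens x'))) ,
    (λ y → odds q y , evens∘odds y) ,
    preserved
    where
      consistent-q : ∀ n → Consistent n q
      consistent-q = forward (isPath⇔consistent q) path
      odds∘evens : ∀ x → odds q (evens q x) ≡ x
      odds∘evens x = inverseˡ (consistent-q (suc (x + x + suc (evens q x + evens q x)))) x
                              (s≤s (m≤m+n _ _)) (s≤s (m≤n+m _ _))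
      evens∘odds : ∀ y → evens q (odds q y) ≡ y
      evens∘odds y = inverseʳ (consistent-q (suc (suc (y + y) + (odds q y + odds q y)))) y
                              (s≤s (m≤m+n _ _)) (s≤s (m≤n+m _ (suc (y + y))))
      preserved : ∀ i (xs : Vec ℕ (ar i)) → A₀ i xs ≡ A₁ i (Vec.map (evens q) xs)
      preserved i xs = preserves (consistent-q (suc (i + (c + c) + c'))) i xs
                         (s≤s (≤-trans (m≤m+n i (c + c)) (m≤m+n _ c')))
                         (s≤s (≤-trans (m≤n+m (c + c) i) (m≤m+n _ c')))
                         (s≤s (m≤n+m c' _))
        where
          c c' : ℕ
          c  = ⌜ toList xs ⌝
          c' = ⌜ toList (Vec.map (evens q) xs) ⌝

  interleave-isPath : (h : Iso ar A₀ A₁) → IsPath tree (interleave (Iso.to h) (Iso.from h))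
  interleave-isPath h = backward (isPath⇔consistent p) λ _ →
    consistent (λ x _ _ → begin
                  odds p (evens p x)   ≡⟨ cong (odds p) (evens-interleave to from x) ⟩
                  odds p (to x)        ≡⟨ odds-interleave to from (to x) ⟩
                  from (to x)          ≡⟨ from∘to x ⟩
                  x                    ∎)
               (λ y _ _ → begin
                  evens p (odds p y)   ≡⟨ cong (evens p) (odds-interleave to from y) ⟩
                  evens p (from y)     ≡⟨ evens-interleave to from (from y) ⟩
                  to (from y)          ≡⟨ to∘from y ⟩
                  y                    ∎)
               (λ i xs _ _ _ → trans (Iso.preserves h i xs)
                                     (cong (A₁ i) (map-cong (λ x → sym (evens-interleave to from x)) xs)))
    where
      open Iso h using (to; from; to∘from; from∘to)
      open ≡-Reasoning
      p : ℕ → ℕ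
      p = interleave to from

  evensᴾ : Program α k → Program α k → Program α k
  evensᴾ S X = app₂ nthᴾ (app₁ doubleᴾ X) S

  oddsᴾ : Program α k → Program α k → Program α k
  oddsᴾ S X = app₂ nthᴾ (app₁ succᴾ (app₁ doubleᴾ X)) S

  ltᴾ : Program α k → Program α k → Program α k
  ltᴾ X L = app₂ monusᴾ L X

  inverseˡᴾ : Program α 2
  inverseˡᴾ = compᴾ (allᴾ (app₂ impᴾ (app₂ andᴾ (ltᴾ (app₁ doubleᴾ π₀) π₁)
                                                (ltᴾ (app₁ succᴾ (app₁ doubleᴾ (evensᴾ π₂ π₀))) π₁))
                                     (app₂ eqᴾ (oddsᴾ π₂ (evensᴾ π₂ π₀)) π₀)))
                    (π₀ ∷ π₀ ∷ π₁ ∷ [])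

  inverseʳᴾ : Program α 2
  inverseʳᴾ = compᴾ (allᴾ (app₂ impᴾ (app₂ andᴾ (ltᴾ (app₁ succᴾ (app₁ doubleᴾ π₀)) π₁)
                                                (ltᴾ (app₁ doubleᴾ (oddsᴾ π₂ π₀)) π₁))
                                     (app₂ eqᴾ (evensᴾ π₂ (oddsᴾ π₂ π₀)) π₀)))
                    (π₀ ∷ π₀ ∷ π₁ ∷ [])

  module _ (arᶜ : ComputableVocab ar) (A₀ᶜ : ComputableStructure ar A₀) (A₁ᶜ : ComputableStructure ar A₁) where

    imageᴾ : Program ∅ 5
    imageᴾ = app₂ andᴾ (ltᴾ (app₁ doubleᴾ π₁) π₃)
               (app₂ andᴾ (app₂ eqᴾ (app₁ lengthᴾ π₁) (app₁ (programFor arᶜ) π₂))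
                 (app₂ andᴾ (app₂ eqᴾ (app₁ lengthᴾ π₀) (app₁ (programFor arᶜ) π₂))
                   (compᴾ (allᴾ (app₂ eqᴾ (app₂ nthᴾ π₀ π₁) (evensᴾ π₃ (app₂ nthᴾ π₀ π₂))))
                          (app₁ lengthᴾ π₁ ∷ π₀ ∷ π₁ ∷ π₄ ∷ []))))

    -- The diagrams are only guaranteed to halt on codes of tuples of the right arity,
    -- so they are consulted, by a primitive recursion on the guard, only once it holds.
    guardedAgreeCode : Code 4
    guardedAgreeCode =
      prec (code (constᴾ {∅} {3} 1))
           (comp (code (eqᴾ {∅})) (comp (proj₁ A₀ᶜ) (proj (suc (suc zero)) ∷ proj (suc (suc (suc zero))) ∷ []) ∷
                                   comp (proj₁ A₁ᶜ) (proj (suc (suc zero)) ∷ proj (suc (suc (suc (suc zero)))) ∷ []) ∷ []))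

    eval-guardedAgree : ∀ v i c c' → (0 < v → lengthᶜ c ≡ ar i × lengthᶜ c' ≡ ar i) →
                        Eval ∅ guardedAgreeCode (v ∷ i ∷ c ∷ c' ∷ []) (impₙ v (agreeₙ i c c'))
    eval-guardedAgree zero    i c c' _     = e-prec0 (eval (constᴾ 1) _)
    eval-guardedAgree (suc v) i c c' arity =
      e-precS (eval-guardedAgree v i c c' (λ _ → arity z<s))
              (e-comp (e-comp (e-proj ∷ e-proj ∷ []) (eval-diagram A₀ᶜ (proj₁ (arity z<s))) ∷
                       e-comp (e-proj ∷ e-proj ∷ []) (eval-diagram A₁ᶜ (proj₂ (arity z<s))) ∷ [])
                      (eval eqᴾ _))

    preservedAtᴾ : Program ∅ 5
    preservedAtᴾ =
      program (comp guardedAgreeCode (code imageᴾ ∷ proj (suc (suc zero)) ∷ proj (suc zero) ∷ proj zero ∷ []))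
              (λ { (c' ∷ c ∷ i ∷ L ∷ s ∷ []) → impₙ (imageₙ L s i c c') (agreeₙ i c c') })
              (λ { (c' ∷ c ∷ i ∷ L ∷ s ∷ []) →
                   e-comp (eval imageᴾ _ ∷ e-proj ∷ e-proj ∷ e-proj ∷ [])
                          (eval-guardedAgree _ i c c' λ image →
                             let (_ , len , len' , _) = forward (imageₙ-pos {L} {s} {i} {c} {c'}) image in len , len') })

    preservesᴾ : Program ∅ 2
    preservesᴾ = compᴾ (allᴾ (compᴾ (allᴾ (compᴾ (allᴾ preservedAtᴾ) (π₂ ∷ π₀ ∷ π₁ ∷ π₂ ∷ π₃ ∷ [])))
                                    (π₁ ∷ π₀ ∷ π₁ ∷ π₂ ∷ [])))
                       (π₀ ∷ π₀ ∷ π₁ ∷ [])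

    treeᴾ : Program ∅ 1
    treeᴾ = app₁ sgᴾ (compᴾ (app₂ andᴾ inverseˡᴾ (app₂ andᴾ inverseʳᴾ preservesᴾ)) (lengthᴾ ∷ π₀ ∷ []))

    tree-isComputable : Σ (Code 1) λ d → ∀ σ → Eval ∅ d (⌜ σ ⌝ ∷ []) (b2n (tree σ))
    tree-isComputable =
      code treeᴾ ,
      λ σ → subst (Eval ∅ (code treeᴾ) (⌜ σ ⌝ ∷ [])) (sym (b2n-nonzero-sg _)) (eval treeᴾ (⌜ σ ⌝ ∷ []))

lemma3 : ∀ (D : ℕ → ℕ) → IsStrongDegreeOfCategoricity D → Treeable D
lemma3 D (ar , arᶜ , _ , _ , (D∈CatSpec , _) , A₀ , A₀ᶜ , A≅A₀ , A₁ , A₁ᶜ , A≅A₁ , isos-compute-D) =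
  tree , (tree-prefixClosed , tree-isComputable arᶜ A₀ᶜ A₁ᶜ) ,
  p , interleave-isPath F , (p≤D , path-computes-D (interleave-isPath F)) ,
  λ q q-isPath → ≤T-trans p≤D (path-computes-D q-isPath)
  where
    open IsoTree A₀ A₁

    F-below-D : Σ (Iso ar A₀ A₁) λ F → Iso.to F ≤T D
    F-below-D = copies-iso-≤T D∈CatSpec A₀ᶜ A≅A₀ A₁ᶜ A≅A₁

    F : Iso ar A₀ A₁
    F = proj₁ F-below-D

    p : ℕ → ℕ
    p = interleave (Iso.to F) (Iso.from F)

    p≤D : p ≤T D
    p≤D = interleave-≤T (proj₂ F-below-D) (Iso.from-≤T F (proj₂ F-below-D))

    path-computes-D : ∀ {q} → IsPath tree q → D ≤T q
    path-computes-D q-isPath = ≤T-trans (isos-compute-D _ (evens-isIso q-isPath)) (evens-≤T _)
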